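{- Let $n\geqslant 3$ be an integer and let $w(n,2)$ denote the width (maximum size of an antichain) of the Bruhat order of $\mathcal{A}(n,2)$. Then \[ w(n,2)\geqslant \frac{|\mathcal{A}(n,2)|}{2n(n-2)+\varepsilon},\] where $\varepsilon=0$ if $n$ is odd and $\varepsilon=1$ if $n$ is even.
   Context: $\mathcal{A}(n,k)$ denotes the class of all $n\times n$ matrices with entries in $\{0,1\}$ in which every row and every column sums to $k$. For an $m\times n$ $(0,1)$-matrix $A=[a_{ij}]$ let $\sigma_{ij}(A)=\sum_{k=1}^{i}\sum_{\ell=1}^{j}a_{k\ell}$. For $A,C$ in the same class, $A\preceq_B C$ (Bruhat order) iff $\sigma_{ij}(A)\geqslant\sigma_{ij}(C)$ for all $i,j$. -}

module Defs where

open import Data.Nat using (ℕ; zero; suc; _+_; _*_; _∸_; _≤_; _≥_; _%_)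
open import Data.Nat.Properties using (_≟_)
open import Data.Bool using (Bool; true; false)
open import Data.List as List using (List; []; _∷_; length; filter; concatMap; take)
open import Data.Nat.ListAction using (sum)
open import Data.Vec as Vec using (Vec; []; _∷_; toList; transpose)
open import Data.Vec.Relation.Unary.All as VAll using (All; all?)
open import Data.Product using (_×_)
open import Relation.Nullary using (¬_; Dec)
open import Relation.Nullary.Decidable using (_×-dec_)
open import Relation.Binary.PropositionalEquality using (_≡_)

-- n × n (0,1)-matrices: a vector of n rows, each a vector of n Booleans
-- (true = entry 1, false = entry 0).
Mat : ℕ → Set
Mat n = Vec (Vec Bool n) n

b2n : Bool → ℕ
b2n true  = 1
b2n false = 0

lineSum : ∀ {n} → Vec Bool n → ℕ
lineSum v = sum (List.map b2n (toList v))

InA : (n k : ℕ) → Mat n → Set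
InA n k M = All (λ r → lineSum r ≡ k) M × All (λ c → lineSum c ≡ k) (transpose M)

inA? : (n k : ℕ) → (M : Mat n) → Dec (InA n k M)
inA? n k M = all? (λ r → lineSum r ≟ k) M ×-dec all? (λ c → lineSum c ≟ k) (transpose M)

vecsOver : ∀ {A : Set} → List A → (m : ℕ) → List (Vec A m)
vecsOver xs zero    = [] ∷ []
vecsOver xs (suc m) = concatMap (λ x → List.map (x ∷_) (vecsOver xs m)) xs

allMats : (n : ℕ) → List (Mat n)
allMats n = vecsOver (vecsOver (true ∷ false ∷ []) n) n

cardA : (n k : ℕ) → ℕ
cardA n k = length (filter (inA? n k) (allMats n))

σ : ∀ {n} → Mat n → ℕ → ℕ → ℕ
σ A i j = sum (List.map (λ r → sum (take j (List.map b2n (toList r)))) (take i (toList A)))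

_⪯B_ : ∀ {n} → Mat n → Mat n → Set
_⪯B_ {n} A C = ∀ i j → 1 ≤ i → i ≤ n → 1 ≤ j → j ≤ n → σ A i j ≥ σ C i j

Incomparable : ∀ {n} → Mat n → Mat n → Set
Incomparable A C = ¬ (A ⪯B C) × ¬ (C ⪯B A)

{-# OPTIONS --safe #-}

-- Let ν(A) be the number of pairs of 1s of A in strictly north-west/south-east position. If
-- A ⪯B C then ν(C) ≤ ν(A), and equality forces A = C: counting, for each 1 of A, the 1s of C
-- north-west of it gives a quantity squeezed between ν(C) and ν(A), and when the squeeze is
-- tight σ(A) and σ(C) agree everywhere, by a backward induction from the last row and column.
-- So every level set of ν is an antichain. For A ∈ 𝒜(n,2) every row holds a 1 with a
-- north-west or south-east partner, whence ν(A) ≥ ⌈n/2⌉; the same holds for north-east/south-west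
-- pairs, and the two kinds together are the 2n² − 3n pairs of 1s sharing neither a row nor a
-- column. Hence ν takes at most 2n(n − 2) + ε values, and by pigeonhole one level set is large.

module Submission where

open import Defs
open import Data.Bool using (Bool; true; false)
open import Data.Empty using (⊥-elim)
open import Data.List as List using (List; []; _∷_; length; take; filter)
open import Data.List.Membership.Propositional using (_∈_)
open import Data.List.Membership.Propositional.Properties using (∈-map⁻)
open import Data.List.Relation.Binary.Disjoint.Propositional using (Disjoint)
open import Data.List.Relation.Binary.Sublist.Propositional.Properties
  using (filter-⊆; length-mono-≤) renaming (filter⁺ to ⊆-filter⁺)
open import Data.List.Relation.Unary.All as All using (All; []; _∷_)
open import Data.List.Relation.Unary.All.Properties as All using (filter⁺; all-filter)
open import Data.List.Relation.Unary.AllPairs as AllPairs using (AllPairs; []; _∷_)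
import Data.List.Relation.Unary.AllPairs.Properties as AllPairs
open import Data.List.Relation.Unary.Unique.Propositional using (Unique)
import Data.List.Relation.Unary.Unique.Propositional.Properties as Unique
open import Data.Nat using (ℕ; zero; suc; _+_; _*_; _∸_; _≤_; _<_; _%_; z≤n; s≤s; ⌈_/2⌉)
open import Data.Nat.DivMod using (m%n<n; [m+n]%n≡m%n)
open import Data.Nat.ListAction using (sum)
open import Data.Nat.Properties
open import Data.Nat.Tactic.RingSolver using (solve-∀)
open import Data.Product using (Σ; ∃; _×_; _,_)
open import Data.Sum using (inj₁; inj₂)
open import Data.Vec using (Vec; []; _∷_; toList; transpose; replicate; _⊛_)
open import Data.Vec.Properties using (∷-injectiveˡ; ∷-injectiveʳ)
open import Data.Vec.Relation.Unary.All as VAll using ([]; _∷_)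
open import Function using (_∘_)
open import Relation.Binary.Definitions using (tri<; tri≈; tri>)
open import Relation.Binary.PropositionalEquality
  using (_≡_; _≢_; refl; sym; trans; cong; cong₂; subst; subst₂; module ≡-Reasoning)
open import Relation.Nullary using (yes; no; ¬?)
open import Relation.Nullary.Decidable using (_×-dec_)
open import Relation.Unary using (Decidable)

∑ : ℕ → (ℕ → ℕ) → ℕ
∑ zero    f = 0
∑ (suc n) f = f 0 + ∑ n (λ k → f (suc k))

syntax ∑ n (λ k → e) = ∑[ k < n ] e

∑-cong : ∀ n {f g : ℕ → ℕ} → (∀ k → k < n → f k ≡ g k) → ∑ n f ≡ ∑ n g
∑-cong zero    _ = refl
∑-cong (suc n) e = cong₂ _+_ (e 0 (s≤s z≤n)) (∑-cong n (λ k k<n → e (suc k) (s≤s k<n)))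

∑-mono-≤ : ∀ n {f g : ℕ → ℕ} → (∀ k → k < n → f k ≤ g k) → ∑ n f ≤ ∑ n g
∑-mono-≤ zero    _ = z≤n
∑-mono-≤ (suc n) e = +-mono-≤ (e 0 (s≤s z≤n)) (∑-mono-≤ n (λ k k<n → e (suc k) (s≤s k<n)))

∑-distrib-+ : ∀ n (f g : ℕ → ℕ) → ∑[ k < n ] (f k + g k) ≡ ∑ n f + ∑ n g
∑-distrib-+ zero    f g = refl
∑-distrib-+ (suc n) f g = begin
  f 0 + g 0 + ∑[ k < n ] (f (suc k) + g (suc k))
    ≡⟨ cong (f 0 + g 0 +_) (∑-distrib-+ n _ _) ⟩
  f 0 + g 0 + (∑[ k < n ] f (suc k) + ∑[ k < n ] g (suc k))
    ≡⟨ +-exchange (f 0) (g 0) _ _ ⟩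
  f 0 + ∑[ k < n ] f (suc k) + (g 0 + ∑[ k < n ] g (suc k)) ∎
  where
  open ≡-Reasoning
  +-exchange : ∀ a b c d → a + b + (c + d) ≡ a + c + (b + d)
  +-exchange = solve-∀

∑-distribˡ : ∀ n c (f : ℕ → ℕ) → c * ∑ n f ≡ ∑[ k < n ] (c * f k)
∑-distribˡ zero    c f = *-zeroʳ c
∑-distribˡ (suc n) c f = trans (*-distribˡ-+ c (f 0) _) (cong (c * f 0 +_) (∑-distribˡ n c _))

∑-distribʳ : ∀ n c (f : ℕ → ℕ) → ∑ n f * c ≡ ∑[ k < n ] (f k * c)
∑-distribʳ n c f =
  trans (*-comm _ c) (trans (∑-distribˡ n c f) (∑-cong n (λ k _ → *-comm c (f k))))

∑-const : ∀ n c → ∑[ _ < n ] c ≡ n * c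
∑-const zero    c = refl
∑-const (suc n) c = cong (c +_) (∑-const n c)

∑-zero : ∀ n → ∑[ _ < n ] 0 ≡ 0
∑-zero n = trans (∑-const n 0) (*-zeroʳ n)

∑-comm : ∀ n m (f : ℕ → ℕ → ℕ) →
         ∑[ i < n ] ∑[ j < m ] f i j ≡ ∑[ j < m ] ∑[ i < n ] f i j
∑-comm zero    m f = sym (∑-zero m)
∑-comm (suc n) m f = trans (cong (∑ m (f 0) +_) (∑-comm n m (λ i → f (suc i))))
                           (sym (∑-distrib-+ m (f 0) (λ j → ∑[ i < n ] f (suc i) j)))

∑-snoc : ∀ n (f : ℕ → ℕ) → ∑ (suc n) f ≡ ∑ n f + f n
∑-snoc zero    f = +-comm (f 0) 0
∑-snoc (suc n) f = trans (cong (f 0 +_) (∑-snoc n (λ k → f (suc k)))) (sym (+-assoc (f 0) _ _))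

term≤∑ : ∀ n (f : ℕ → ℕ) {k} → k < n → f k ≤ ∑ n f
term≤∑ (suc n) f {zero}  _         = m≤m+n (f 0) _
term≤∑ (suc n) f {suc k} (s≤s k<n) = ≤-trans (term≤∑ n (λ i → f (suc i)) k<n) (m≤n+m _ (f 0))

∑≤term : ∀ n (f : ℕ → ℕ) l → (∀ k → k < n → k ≢ l → f k ≡ 0) → ∑ n f ≤ f l
∑≤term zero    f l       _    = z≤n
∑≤term (suc n) f zero    rest = ≤-reflexive (begin
  f 0 + ∑[ k < n ] f (suc k) ≡⟨ cong (f 0 +_) (∑-cong n (λ k k<n → rest (suc k) (s≤s k<n) λ ())) ⟩
  f 0 + ∑[ _ < n ] 0         ≡⟨ cong (f 0 +_) (∑-zero n) ⟩
  f 0 + 0                    ≡⟨ +-identityʳ (f 0) ⟩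
  f 0                        ∎)
  where open ≡-Reasoning
∑≤term (suc n) f (suc l) rest = begin
  f 0 + ∑[ k < n ] f (suc k) ≡⟨ cong (_+ ∑[ k < n ] f (suc k)) (rest 0 (s≤s z≤n) λ ()) ⟩
  ∑[ k < n ] f (suc k)       ≤⟨ ∑≤term n (λ k → f (suc k)) l rest′ ⟩
  f (suc l)                  ∎
  where
  open ≤-Reasoning
  rest′ : ∀ k → k < n → k ≢ l → f (suc k) ≡ 0
  rest′ k k<n k≢l = rest (suc k) (s≤s k<n) (k≢l ∘ suc-injective)

∑-≡-pointwise : ∀ n {f g : ℕ → ℕ} → (∀ k → k < n → g k ≤ f k) → ∑ n f ≡ ∑ n g →
                ∀ k → k < n → f k ≡ g k
∑-≡-pointwise (suc n) {f} {g} g≤f eq = pointwise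
  where
  head≡ : f 0 ≡ g 0
  head≡ = ≤-antisym (+-cancelʳ-≤ _ _ _ (≤-trans (≤-reflexive eq)
                        (+-monoʳ-≤ (g 0) (∑-mono-≤ n (λ k k<n → g≤f (suc k) (s≤s k<n))))))
                    (g≤f 0 (s≤s z≤n))
  tail≡ : ∑[ k < n ] f (suc k) ≡ ∑[ k < n ] g (suc k)
  tail≡ = +-cancelˡ-≡ (f 0) _ _ (trans eq (cong (_+ _) (sym head≡)))
  pointwise : ∀ k → k < suc n → f k ≡ g k
  pointwise zero    _         = head≡
  pointwise (suc k) (s≤s k<n) = ∑-≡-pointwise n (λ i i<n → g≤f (suc i) (s≤s i<n)) tail≡ k k<n

∑-square : ∀ n (v : ℕ → ℕ) →
  2 * ∑[ k < n ] (v k * ∑ k v) + ∑[ k < n ] (v k * v k) ≡ ∑ n v * ∑ n v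
∑-square zero    v = refl
∑-square (suc n) v = begin
  2 * (v 0 * 0 + ∑[ k < n ] (w k * ∑ (suc k) v)) + (v 0 * v 0 + ∑[ k < n ] (w k * w k))
    ≡⟨ cong (λ x → 2 * (v 0 * 0 + x) + (v 0 * v 0 + ∑[ k < n ] (w k * w k))) peel ⟩
  2 * (v 0 * 0 + (v 0 * ∑ n w + ∑[ k < n ] (w k * ∑ k w))) + (v 0 * v 0 + ∑[ k < n ] (w k * w k))
    ≡⟨ regroup (v 0) (∑ n w) (∑[ k < n ] (w k * ∑ k w)) (∑[ k < n ] (w k * w k)) ⟩
  v 0 * v 0 + 2 * (v 0 * ∑ n w) + (2 * ∑[ k < n ] (w k * ∑ k w) + ∑[ k < n ] (w k * w k))
    ≡⟨ cong (v 0 * v 0 + 2 * (v 0 * ∑ n w) +_) (∑-square n w) ⟩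
  v 0 * v 0 + 2 * (v 0 * ∑ n w) + ∑ n w * ∑ n w
    ≡⟨ binomial (v 0) (∑ n w) ⟩
  (v 0 + ∑ n w) * (v 0 + ∑ n w) ∎
  where
  open ≡-Reasoning
  w : ℕ → ℕ
  w k = v (suc k)
  peel : ∑[ k < n ] (w k * ∑ (suc k) v) ≡ v 0 * ∑ n w + ∑[ k < n ] (w k * ∑ k w)
  peel = begin
    ∑[ k < n ] (w k * (v 0 + ∑ k w))
      ≡⟨ ∑-cong n (λ k _ → *-distribˡ-+ (w k) (v 0) (∑ k w)) ⟩
    ∑[ k < n ] (w k * v 0 + w k * ∑ k w)
      ≡⟨ ∑-distrib-+ n _ _ ⟩
    ∑[ k < n ] (w k * v 0) + ∑[ k < n ] (w k * ∑ k w)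
      ≡⟨ cong (_+ ∑[ k < n ] (w k * ∑ k w)) (trans (sym (∑-distribʳ n (v 0) w)) (*-comm (∑ n w) (v 0))) ⟩
    v 0 * ∑ n w + ∑[ k < n ] (w k * ∑ k w) ∎
  regroup : ∀ a b x q → 2 * (a * 0 + (a * b + x)) + (a * a + q) ≡ a * a + 2 * (a * b) + (2 * x + q)
  regroup = solve-∀
  binomial : ∀ a b → a * a + 2 * (a * b) + b * b ≡ (a + b) * (a + b)
  binomial = solve-∀

∑-triangle : ∀ n → 2 * ∑[ k < n ] k + n ≡ n * n
∑-triangle zero    = refl
∑-triangle (suc n) = begin
  2 * ∑ (suc n) (λ k → k) + suc n   ≡⟨ cong (λ x → 2 * x + suc n) (∑-snoc n (λ k → k)) ⟩
  2 * (∑[ k < n ] k + n) + suc n    ≡⟨ regroup (∑[ k < n ] k) n ⟩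
  2 * ∑[ k < n ] k + n + (2 * n + 1) ≡⟨ cong (_+ (2 * n + 1)) (∑-triangle n) ⟩
  n * n + (2 * n + 1)               ≡⟨ square-suc n ⟩
  suc n * suc n ∎
  where
  open ≡-Reasoning
  regroup : ∀ t n → 2 * (t + n) + suc n ≡ 2 * t + n + (2 * n + 1)
  regroup = solve-∀
  square-suc : ∀ n → n * n + (2 * n + 1) ≡ suc n * suc n
  square-suc = solve-∀

[_<_] : ℕ → ℕ → ℕ
[ _     < zero  ] = 0
[ zero  < suc _ ] = 1
[ suc k < suc i ] = [ k < i ]

[<]≡1 : ∀ {k i} → k < i → [ k < i ] ≡ 1
[<]≡1 {zero}  {suc i} _         = refl
[<]≡1 {suc k} {suc i} (s≤s k<i) = [<]≡1 k<i

[<]+[≥]≡1 : ∀ k i → [ k < i ] + [ i < suc k ] ≡ 1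
[<]+[≥]≡1 zero    zero    = refl
[<]+[≥]≡1 zero    (suc i) = refl
[<]+[≥]≡1 (suc k) zero    = refl
[<]+[≥]≡1 (suc k) (suc i) = [<]+[≥]≡1 k i

∑-truncate : ∀ n i (f : ℕ → ℕ) → i ≤ n → ∑ i f ≡ ∑[ k < n ] ([ k < i ] * f k)
∑-truncate n       zero    f _         = sym (∑-zero n)
∑-truncate (suc n) (suc i) f (s≤s i≤n) =
  cong₂ _+_ (sym (+-identityʳ (f 0))) (∑-truncate n i (λ k → f (suc k)) i≤n)

∑[<] : ∀ n i → i ≤ n → ∑[ k < n ] [ k < i ] ≡ i
∑[<] n i i≤n = begin
  ∑[ k < n ] [ k < i ]       ≡⟨ ∑-cong n (λ k _ → sym (*-identityʳ [ k < i ])) ⟩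
  ∑[ k < n ] ([ k < i ] * 1) ≡⟨ sym (∑-truncate n i (λ _ → 1) i≤n) ⟩
  ∑[ _ < i ] 1               ≡⟨ trans (∑-const i 1) (*-identityʳ i) ⟩
  i ∎
  where open ≡-Reasoning

leadingSum : (ℕ → ℕ → ℕ) → ℕ → ℕ → ℕ
leadingSum a i j = ∑[ k < i ] ∑[ l < j ] a k l

leadingSum-rectangle : ∀ a i j →
  leadingSum a (suc i) (suc j) + leadingSum a i j ≡
  leadingSum a i (suc j) + leadingSum a (suc i) j + a i j
leadingSum-rectangle a i j = begin
  leadingSum a (suc i) (suc j) + leadingSum a i j
    ≡⟨ cong (_+ leadingSum a i j) (∑-snoc i (λ k → ∑ (suc j) (a k))) ⟩
  leadingSum a i (suc j) + ∑ (suc j) (a i) + leadingSum a i j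
    ≡⟨ cong (λ r → leadingSum a i (suc j) + r + leadingSum a i j) (∑-snoc j (a i)) ⟩
  leadingSum a i (suc j) + (∑ j (a i) + a i j) + leadingSum a i j
    ≡⟨ rearrange (leadingSum a i (suc j)) (∑ j (a i)) (a i j) (leadingSum a i j) ⟩
  leadingSum a i (suc j) + (leadingSum a i j + ∑ j (a i)) + a i j
    ≡⟨ cong (λ r → leadingSum a i (suc j) + r + a i j) (sym (∑-snoc i (λ k → ∑ j (a k)))) ⟩
  leadingSum a i (suc j) + leadingSum a (suc i) j + a i j ∎
  where
  open ≡-Reasoning
  rearrange : ∀ p q r s → p + (q + r) + s ≡ p + (s + q) + r
  rearrange = solve-∀

leadingSum-extend : ∀ a i j → leadingSum a i (suc j) ≡ leadingSum a i j + ∑[ r < i ] a r j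
leadingSum-extend a i j = trans (∑-cong i (λ r _ → ∑-snoc j (a r))) (∑-distrib-+ i _ _)

module Quadrants (n : ℕ) where

  ∑∑ : (ℕ → ℕ → ℕ) → ℕ
  ∑∑ F = ∑[ k < n ] ∑[ l < n ] F k l

  ∑∑-cong : ∀ {F G} → (∀ k l → k < n → l < n → F k l ≡ G k l) → ∑∑ F ≡ ∑∑ G
  ∑∑-cong e = ∑-cong n (λ k k<n → ∑-cong n (λ l l<n → e k l k<n l<n))

  ∑∑-mono-≤ : ∀ {F G} → (∀ k l → k < n → l < n → F k l ≤ G k l) → ∑∑ F ≤ ∑∑ G
  ∑∑-mono-≤ e = ∑-mono-≤ n (λ k k<n → ∑-mono-≤ n (λ l l<n → e k l k<n l<n))

  ∑∑-distrib-+ : ∀ F G → ∑∑ (λ k l → F k l + G k l) ≡ ∑∑ F + ∑∑ G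
  ∑∑-distrib-+ F G = trans (∑-cong n (λ k _ → ∑-distrib-+ n (F k) (G k))) (∑-distrib-+ n _ _)

  ∑∑-transpose : ∀ F → ∑∑ F ≡ ∑∑ (λ k l → F l k)
  ∑∑-transpose F = ∑-comm n n F

  term≤∑∑ : ∀ F {k l} → k < n → l < n → F k l ≤ ∑∑ F
  term≤∑∑ F {k} k<n l<n = ≤-trans (term≤∑ n (F k) l<n) (term≤∑ n (λ k → ∑ n (F k)) k<n)

  ∑∑-≡-pointwise : ∀ {F G} → (∀ k l → k < n → l < n → G k l ≤ F k l) → ∑∑ F ≡ ∑∑ G →
                   ∀ k l → k < n → l < n → F k l ≡ G k l
  ∑∑-≡-pointwise G≤F eq k l k<n l<n =
    ∑-≡-pointwise n (λ l l<n → G≤F k l k<n l<n)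
      (∑-≡-pointwise n (λ k k<n → ∑-mono-≤ n (λ l l<n → G≤F k l k<n l<n)) eq k k<n) l l<n

  mass : (ℕ → ℕ → ℕ) → (ℕ → ℕ → ℕ) → ℕ
  mass a P = ∑∑ (λ k l → a k l * P k l)

  mass-cong : ∀ a {P R} → (∀ k l → k < n → l < n → P k l ≡ R k l) → mass a P ≡ mass a R
  mass-cong a e = ∑∑-cong (λ k l k<n l<n → cong (a k l *_) (e k l k<n l<n))

  mass-distrib-+ : ∀ a P R → mass a (λ k l → P k l + R k l) ≡ mass a P + mass a R
  mass-distrib-+ a P R =
    trans (∑∑-cong (λ k l _ _ → *-distribˡ-+ (a k l) (P k l) (R k l))) (∑∑-distrib-+ _ _)

  entry≤mass : ∀ a P {k l} → k < n → l < n → P k l ≡ 1 → a k l ≤ mass a P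
  entry≤mass a P {k} {l} k<n l<n Pkl≡1 =
    subst (_≤ mass a P) (trans (cong (a k l *_) Pkl≡1) (*-identityʳ (a k l)))
      (term≤∑∑ (λ k l → a k l * P k l) k<n l<n)

  ∑∑-comm : ∀ (F : ℕ → ℕ → ℕ → ℕ → ℕ) →
    ∑∑ (λ k l → ∑∑ (λ k′ l′ → F k l k′ l′)) ≡ ∑∑ (λ k′ l′ → ∑∑ (λ k l → F k l k′ l′))
  ∑∑-comm F = begin
    ∑[ k < n ] ∑[ l < n ] ∑[ k′ < n ] ∑[ l′ < n ] F k l k′ l′
      ≡⟨ ∑-cong n (λ k _ → ∑-comm n n (λ l k′ → ∑[ l′ < n ] F k l k′ l′)) ⟩
    ∑[ k < n ] ∑[ k′ < n ] ∑[ l < n ] ∑[ l′ < n ] F k l k′ l′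
      ≡⟨ ∑-comm n n (λ k k′ → ∑[ l < n ] ∑[ l′ < n ] F k l k′ l′) ⟩
    ∑[ k′ < n ] ∑[ k < n ] ∑[ l < n ] ∑[ l′ < n ] F k l k′ l′
      ≡⟨ ∑-cong n (λ k′ _ → ∑-cong n (λ k _ → ∑-comm n n (λ l l′ → F k l k′ l′))) ⟩
    ∑[ k′ < n ] ∑[ k < n ] ∑[ l′ < n ] ∑[ l < n ] F k l k′ l′
      ≡⟨ ∑-cong n (λ k′ _ → ∑-comm n n (λ k l′ → ∑[ l < n ] F k l k′ l′)) ⟩
    ∑[ k′ < n ] ∑[ l′ < n ] ∑[ k < n ] ∑[ l < n ] F k l k′ l′ ∎
    where open ≡-Reasoning

  mass-mass-comm : ∀ a c (R : ℕ → ℕ → ℕ → ℕ → ℕ) →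
    ∑∑ (λ k l → a k l * mass c (R k l)) ≡
    ∑∑ (λ k′ l′ → c k′ l′ * mass a (λ k l → R k l k′ l′))
  mass-mass-comm a c R = begin
    ∑∑ (λ k l → a k l * mass c (R k l))
      ≡⟨ ∑∑-cong (λ k l _ _ → pull (a k l) (λ k′ l′ → c k′ l′ * R k l k′ l′)) ⟩
    ∑∑ (λ k l → ∑∑ (λ k′ l′ → a k l * (c k′ l′ * R k l k′ l′)))
      ≡⟨ ∑∑-comm _ ⟩
    ∑∑ (λ k′ l′ → ∑∑ (λ k l → a k l * (c k′ l′ * R k l k′ l′)))
      ≡⟨ ∑∑-cong (λ k′ l′ _ _ → ∑∑-cong (λ k l _ _ → *-swapˡ (a k l) (c k′ l′) _)) ⟩
    ∑∑ (λ k′ l′ → ∑∑ (λ k l → c k′ l′ * (a k l * R k l k′ l′)))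
      ≡⟨ ∑∑-cong (λ k′ l′ _ _ → sym (pull (c k′ l′) (λ k l → a k l * R k l k′ l′))) ⟩
    ∑∑ (λ k′ l′ → c k′ l′ * mass a (λ k l → R k l k′ l′)) ∎
    where
    open ≡-Reasoning
    pull : ∀ x F → x * ∑∑ F ≡ ∑∑ (λ k l → x * F k l)
    pull x F = trans (∑-distribˡ n x _) (∑-cong n (λ k _ → ∑-distribˡ n x (F k)))
    *-swapˡ : ∀ x y z → x * (y * z) ≡ y * (x * z)
    *-swapˡ = solve-∀

  -- [ i < suc k ] is the indicator of i ≤ k: SE a i j counts the 1s in rows ≥ i and columns ≥ j.
  NW NE SW SE : (ℕ → ℕ → ℕ) → ℕ → ℕ → ℕ
  NW a i j = mass a (λ k l → [ k < i ] * [ l < j ])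
  NE a i j = mass a (λ k l → [ k < i ] * [ j < suc l ])
  SW a i j = mass a (λ k l → [ i < suc k ] * [ l < j ])
  SE a i j = mass a (λ k l → [ i < suc k ] * [ j < suc l ])

  leadingSum≡NW : ∀ a {i j} → i ≤ n → j ≤ n → leadingSum a i j ≡ NW a i j
  leadingSum≡NW a {i} {j} i≤n j≤n = begin
    ∑[ k < i ] ∑[ l < j ] a k l
      ≡⟨ ∑-truncate n i _ i≤n ⟩
    ∑[ k < n ] ([ k < i ] * ∑[ l < j ] a k l)
      ≡⟨ ∑-cong n (λ k _ → cong ([ k < i ] *_) (∑-truncate n j (a k) j≤n)) ⟩
    ∑[ k < n ] ([ k < i ] * ∑[ l < n ] ([ l < j ] * a k l))
      ≡⟨ ∑-cong n (λ k _ → ∑-distribˡ n [ k < i ] _) ⟩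
    ∑[ k < n ] ∑[ l < n ] ([ k < i ] * ([ l < j ] * a k l))
      ≡⟨ ∑∑-cong (λ k l _ _ → rearrange [ k < i ] [ l < j ] (a k l)) ⟩
    NW a i j ∎
    where
    open ≡-Reasoning
    rearrange : ∀ x y z → x * (y * z) ≡ z * (x * y)
    rearrange = solve-∀

  record Regular (k : ℕ) (a : ℕ → ℕ → ℕ) : Set where
    field
      row-sum : ∀ i → i < n → ∑[ l < n ] a i l ≡ k
      col-sum : ∀ l → l < n → ∑[ i < n ] a i l ≡ k

  module RegularProperties {k a} (reg : Regular k a) where
    open Regular reg

    mass-rows : ∀ i → i ≤ n → mass a (λ r _ → [ r < i ]) ≡ i * k
    mass-rows i i≤n = begin
      ∑[ r < n ] ∑[ l < n ] (a r l * [ r < i ])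
        ≡⟨ ∑-cong n (λ r _ → sym (∑-distribʳ n [ r < i ] (a r))) ⟩
      ∑[ r < n ] (∑ n (a r) * [ r < i ])
        ≡⟨ ∑-cong n (λ r r<n → cong (_* [ r < i ]) (row-sum r r<n)) ⟩
      ∑[ r < n ] (k * [ r < i ])                ≡⟨ sym (∑-distribˡ n k _) ⟩
      k * ∑[ r < n ] [ r < i ]                  ≡⟨ cong (k *_) (∑[<] n i i≤n) ⟩
      k * i                                     ≡⟨ *-comm k i ⟩
      i * k ∎
      where open ≡-Reasoning

    mass-cols : ∀ j → j ≤ n → mass a (λ _ c → [ c < j ]) ≡ j * k
    mass-cols j j≤n = begin
      ∑[ r < n ] ∑[ c < n ] (a r c * [ c < j ]) ≡⟨ ∑∑-transpose _ ⟩
      ∑[ c < n ] ∑[ r < n ] (a r c * [ c < j ])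
        ≡⟨ ∑-cong n (λ c _ → sym (∑-distribʳ n [ c < j ] (λ r → a r c))) ⟩
      ∑[ c < n ] (∑[ r < n ] a r c * [ c < j ])
        ≡⟨ ∑-cong n (λ c c<n → cong (_* [ c < j ]) (col-sum c c<n)) ⟩
      ∑[ c < n ] (k * [ c < j ])                ≡⟨ sym (∑-distribˡ n k _) ⟩
      k * ∑[ c < n ] [ c < j ]                  ≡⟨ cong (k *_) (∑[<] n j j≤n) ⟩
      k * j                                     ≡⟨ *-comm k j ⟩
      j * k ∎
      where open ≡-Reasoning

    NW+NE : ∀ i j → i ≤ n → NW a i j + NE a i j ≡ i * k
    NW+NE i j i≤n = trans (sym (mass-distrib-+ a _ _)) (trans (mass-cong a split) (mass-rows i i≤n))
      where
      split : ∀ r c → r < n → c < n → [ r < i ] * [ c < j ] + [ r < i ] * [ j < suc c ] ≡ [ r < i ]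
      split r c _ _ = begin
        [ r < i ] * [ c < j ] + [ r < i ] * [ j < suc c ] ≡⟨ sym (*-distribˡ-+ [ r < i ] _ _) ⟩
        [ r < i ] * ([ c < j ] + [ j < suc c ])           ≡⟨ cong ([ r < i ] *_) ([<]+[≥]≡1 c j) ⟩
        [ r < i ] * 1                                     ≡⟨ *-identityʳ [ r < i ] ⟩
        [ r < i ] ∎
        where open ≡-Reasoning

    NW+SW : ∀ i j → j ≤ n → NW a i j + SW a i j ≡ j * k
    NW+SW i j j≤n = trans (sym (mass-distrib-+ a _ _)) (trans (mass-cong a split) (mass-cols j j≤n))
      where
      split : ∀ r c → r < n → c < n → [ r < i ] * [ c < j ] + [ i < suc r ] * [ c < j ] ≡ [ c < j ]
      split r c _ _ = begin
        [ r < i ] * [ c < j ] + [ i < suc r ] * [ c < j ] ≡⟨ sym (*-distribʳ-+ [ c < j ] [ r < i ] _) ⟩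
        ([ r < i ] + [ i < suc r ]) * [ c < j ]           ≡⟨ cong (_* [ c < j ]) ([<]+[≥]≡1 r i) ⟩
        1 * [ c < j ]                                     ≡⟨ *-identityˡ [ c < j ] ⟩
        [ c < j ] ∎
        where open ≡-Reasoning

    mass-all : mass a (λ _ _ → 1) ≡ n * k
    mass-all = trans (mass-cong a (λ r _ r<n _ → sym ([<]≡1 r<n))) (mass-rows n ≤-refl)

    NW+NE+SW+SE : ∀ i j → NW a i j + NE a i j + (SW a i j + SE a i j) ≡ n * k
    NW+NE+SW+SE i j = begin
      NW a i j + NE a i j + (SW a i j + SE a i j)
        ≡⟨ sym (cong₂ _+_ (mass-distrib-+ a _ _) (mass-distrib-+ a _ _)) ⟩
      mass a (λ r c → [ r < i ] * [ c < j ] + [ r < i ] * [ j < suc c ]) +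
      mass a (λ r c → [ i < suc r ] * [ c < j ] + [ i < suc r ] * [ j < suc c ])
        ≡⟨ sym (mass-distrib-+ a _ _) ⟩
      mass a (λ r c → [ r < i ] * [ c < j ] + [ r < i ] * [ j < suc c ] +
                      ([ i < suc r ] * [ c < j ] + [ i < suc r ] * [ j < suc c ]))
        ≡⟨ mass-cong a (λ r c _ _ → trans (expand [ r < i ] [ i < suc r ] [ c < j ] [ j < suc c ])
                                          (cong₂ _*_ ([<]+[≥]≡1 r i) ([<]+[≥]≡1 c j))) ⟩
      mass a (λ _ _ → 1)
        ≡⟨ mass-all ⟩
      n * k ∎
      where
      open ≡-Reasoning
      expand : ∀ x x′ y y′ → x * y + x * y′ + (x′ * y + x′ * y′) ≡ (x + x′) * (y + y′)
      expand = solve-∀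

    SE-balance : ∀ i j → i ≤ n → j ≤ n → SE a i j + i * k + j * k ≡ n * k + NW a i j
    SE-balance i j i≤n j≤n = begin
      SE a i j + i * k + j * k
        ≡⟨ cong₂ (λ p q → SE a i j + p + q) (sym (NW+NE i j i≤n)) (sym (NW+SW i j j≤n)) ⟩
      SE a i j + (NW a i j + NE a i j) + (NW a i j + SW a i j)
        ≡⟨ rearrange (SE a i j) (NW a i j) (NE a i j) (SW a i j) ⟩
      NW a i j + NE a i j + (SW a i j + SE a i j) + NW a i j
        ≡⟨ cong (_+ NW a i j) (NW+NE+SW+SE i j) ⟩
      n * k + NW a i j ∎
      where
      open ≡-Reasoning
      rearrange : ∀ se nw ne sw → se + (nw + ne) + (nw + sw) ≡ nw + ne + (sw + se) + nw
      rearrange = solve-∀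

    NE-balance : ∀ i j → i ≤ n → j ≤ n → NE a i j + j * k ≡ i * k + SW a i j
    NE-balance i j i≤n j≤n = begin
      NE a i j + j * k                 ≡⟨ cong (NE a i j +_) (sym (NW+SW i j j≤n)) ⟩
      NE a i j + (NW a i j + SW a i j) ≡⟨ rearrange (NE a i j) (NW a i j) (SW a i j) ⟩
      NW a i j + NE a i j + SW a i j   ≡⟨ cong (_+ SW a i j) (NW+NE i j i≤n) ⟩
      i * k + SW a i j ∎
      where
      open ≡-Reasoning
      rearrange : ∀ ne nw sw → ne + (nw + sw) ≡ nw + ne + sw
      rearrange = solve-∀

    leadingSum-full-width : ∀ i → i ≤ n → leadingSum a i n ≡ i * k
    leadingSum-full-width i i≤n =
      trans (∑-cong i (λ r r<i → row-sum r (<-≤-trans r<i i≤n))) (∑-const i k)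

    leadingSum-full-height : ∀ j → j ≤ n → leadingSum a n j ≡ j * k
    leadingSum-full-height j j≤n =
      trans (∑-comm n j a)
            (trans (∑-cong j (λ c c<j → col-sum c (<-≤-trans c<j j≤n))) (∑-const j k))

module Rigidity (n : ℕ) where
  open Quadrants n

  nwPairsBetween : (ℕ → ℕ → ℕ) → (ℕ → ℕ → ℕ) → ℕ
  nwPairsBetween a c = ∑∑ (λ k l → a k l * NW c k l)

  nwPairs : (ℕ → ℕ → ℕ) → ℕ
  nwPairs a = nwPairsBetween a a

  nwPairsBetween-via-SE : ∀ a c → nwPairsBetween a c ≡ ∑∑ (λ k l → c k l * SE a (suc k) (suc l))
  nwPairsBetween-via-SE a c = mass-mass-comm a c (λ k l k′ l′ → [ k′ < k ] * [ l′ < l ])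

  Dominates : (ℕ → ℕ → ℕ) → (ℕ → ℕ → ℕ) → Set
  Dominates a c = ∀ i j → i ≤ n → j ≤ n → leadingSum c i j ≤ leadingSum a i j

  module _ {k a c} (reg-a : Regular k a) (reg-c : Regular k c) (dom : Dominates a c) where
    open RegularProperties

    NW-dominance : ∀ i j → i ≤ n → j ≤ n → NW c i j ≤ NW a i j
    NW-dominance i j i≤n j≤n =
      subst₂ _≤_ (leadingSum≡NW c i≤n j≤n) (leadingSum≡NW a i≤n j≤n) (dom i j i≤n j≤n)

    SE-dominance : ∀ i j → i ≤ n → j ≤ n → SE c i j ≤ SE a i j
    SE-dominance i j i≤n j≤n = +-cancelʳ-≤ (i * k + j * k) _ _ (begin
      SE c i j + (i * k + j * k) ≡⟨ sym (+-assoc (SE c i j) _ _) ⟩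
      SE c i j + i * k + j * k   ≡⟨ SE-balance reg-c i j i≤n j≤n ⟩
      n * k + NW c i j           ≤⟨ +-monoʳ-≤ (n * k) (NW-dominance i j i≤n j≤n) ⟩
      n * k + NW a i j           ≡⟨ sym (SE-balance reg-a i j i≤n j≤n) ⟩
      SE a i j + i * k + j * k   ≡⟨ +-assoc (SE a i j) _ _ ⟩
      SE a i j + (i * k + j * k) ∎)
      where open ≤-Reasoning

    nwPairsBetween≤nwPairs : nwPairsBetween a c ≤ nwPairs a
    nwPairsBetween≤nwPairs =
      ∑∑-mono-≤ (λ i j i<n j<n → *-monoʳ-≤ (a i j) (NW-dominance i j (<⇒≤ i<n) (<⇒≤ j<n)))

    nwPairs≤nwPairsBetween : nwPairs c ≤ nwPairsBetween a c
    nwPairs≤nwPairsBetween = begin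
      nwPairs c                                        ≡⟨ nwPairsBetween-via-SE c c ⟩
      ∑∑ (λ i j → c i j * SE c (suc i) (suc j))
        ≤⟨ ∑∑-mono-≤ (λ i j i<n j<n → *-monoʳ-≤ (c i j) (SE-dominance (suc i) (suc j) i<n j<n)) ⟩
      ∑∑ (λ i j → c i j * SE a (suc i) (suc j))        ≡⟨ sym (nwPairsBetween-via-SE a c) ⟩
      nwPairsBetween a c ∎
      where open ≤-Reasoning

    module _ (same-nwPairs : nwPairs a ≡ nwPairs c) where

      ones-of-a-see-same-NW : ∀ i j → i < n → j < n →
                              a i j * leadingSum a i j ≡ a i j * leadingSum c i j
      ones-of-a-see-same-NW i j i<n j<n =
        subst₂ (λ x y → a i j * x ≡ a i j * y)
          (sym (leadingSum≡NW a (<⇒≤ i<n) (<⇒≤ j<n))) (sym (leadingSum≡NW c (<⇒≤ i<n) (<⇒≤ j<n)))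
          (∑∑-≡-pointwise termwise-≤ squeezed i j i<n j<n)
        where
        termwise-≤ : ∀ i j → i < n → j < n → a i j * NW c i j ≤ a i j * NW a i j
        termwise-≤ i j i<n j<n = *-monoʳ-≤ (a i j) (NW-dominance i j (<⇒≤ i<n) (<⇒≤ j<n))
        squeezed : nwPairs a ≡ nwPairsBetween a c
        squeezed = ≤-antisym (≤-trans (≤-reflexive same-nwPairs) nwPairs≤nwPairsBetween)
                             nwPairsBetween≤nwPairs

      -- Where a i j > 0 this is the previous lemma; where a i j = 0 the rectangle identity
      -- gives the inequality opposite to dominance.
      leadingSum-≡-step : ∀ i j → i < n → j < n →
        leadingSum a (suc i) (suc j) ≡ leadingSum c (suc i) (suc j) →
        leadingSum a i (suc j) ≡ leadingSum c i (suc j) →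
        leadingSum a (suc i) j ≡ leadingSum c (suc i) j →
        leadingSum a i j ≡ leadingSum c i j
      leadingSum-≡-step i j i<n j<n ≡ᵢ₊₁ⱼ₊₁ ≡ᵢⱼ₊₁ ≡ᵢ₊₁ⱼ with a i j in aᵢⱼ≡
      ... | suc m = *-cancelˡ-≡ (leadingSum a i j) _ (suc m)
        (subst (λ x → x * leadingSum a i j ≡ x * leadingSum c i j) aᵢⱼ≡ (ones-of-a-see-same-NW i j i<n j<n))
      ... | zero  = ≤-antisym (+-cancelˡ-≤ (leadingSum a (suc i) (suc j)) _ _ (begin
        leadingSum a (suc i) (suc j) + leadingSum a i j
          ≡⟨ leadingSum-rectangle a i j ⟩
        leadingSum a i (suc j) + leadingSum a (suc i) j + a i j
          ≡⟨ cong₂ (λ p q → p + q + a i j) ≡ᵢⱼ₊₁ ≡ᵢ₊₁ⱼ ⟩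
        leadingSum c i (suc j) + leadingSum c (suc i) j + a i j
          ≡⟨ cong (_ +_) aᵢⱼ≡ ⟩
        leadingSum c i (suc j) + leadingSum c (suc i) j + 0
          ≤⟨ +-monoʳ-≤ _ z≤n ⟩
        leadingSum c i (suc j) + leadingSum c (suc i) j + c i j
          ≡⟨ sym (leadingSum-rectangle c i j) ⟩
        leadingSum c (suc i) (suc j) + leadingSum c i j
          ≡⟨ cong (_+ leadingSum c i j) (sym ≡ᵢ₊₁ⱼ₊₁) ⟩
        leadingSum a (suc i) (suc j) + leadingSum c i j ∎))
        (dom i j (<⇒≤ i<n) (<⇒≤ j<n))
        where open ≤-Reasoning

      leadingSum-≡-from-corner : ∀ u v {i j} → u + i ≡ n → v + j ≡ n →
                                 leadingSum a i j ≡ leadingSum c i j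
      leadingSum-≡-from-corner zero v {i} {j} refl v+j≡n =
        trans (leadingSum-full-height reg-a j j≤n) (sym (leadingSum-full-height reg-c j j≤n))
        where
        j≤n : j ≤ n
        j≤n = subst (j ≤_) v+j≡n (m≤n+m j v)
      leadingSum-≡-from-corner (suc u) zero {i} {j} u+i≡n refl =
        trans (leadingSum-full-width reg-a i i≤n) (sym (leadingSum-full-width reg-c i i≤n))
        where
        i≤n : i ≤ n
        i≤n = subst (i ≤_) u+i≡n (m≤n+m i (suc u))
      leadingSum-≡-from-corner (suc u) (suc v) {i} {j} u+i≡n v+j≡n =
        leadingSum-≡-step i j (subst (i <_) u+i≡n (s≤s (m≤n+m i u))) (subst (j <_) v+j≡n (s≤s (m≤n+m j v)))
          (leadingSum-≡-from-corner u v (trans (+-suc u i) u+i≡n) (trans (+-suc v j) v+j≡n))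
          (leadingSum-≡-from-corner (suc u) v u+i≡n (trans (+-suc v j) v+j≡n))
          (leadingSum-≡-from-corner u (suc v) (trans (+-suc u i) u+i≡n) v+j≡n)

      leadingSum-≡ : ∀ i j → i ≤ n → j ≤ n → leadingSum a i j ≡ leadingSum c i j
      leadingSum-≡ i j i≤n j≤n =
        leadingSum-≡-from-corner (n ∸ i) (n ∸ j) (m∸n+n≡m i≤n) (m∸n+n≡m j≤n)

      entries-≡ : ∀ i j → i < n → j < n → a i j ≡ c i j
      entries-≡ i j i<n j<n = +-cancelˡ-≡ (leadingSum a i (suc j) + leadingSum a (suc i) j) _ _ (begin
        leadingSum a i (suc j) + leadingSum a (suc i) j + a i j
          ≡⟨ sym (leadingSum-rectangle a i j) ⟩
        leadingSum a (suc i) (suc j) + leadingSum a i j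
          ≡⟨ cong₂ _+_ (leadingSum-≡ (suc i) (suc j) i<n j<n) (leadingSum-≡ i j i≤n j≤n) ⟩
        leadingSum c (suc i) (suc j) + leadingSum c i j
          ≡⟨ leadingSum-rectangle c i j ⟩
        leadingSum c i (suc j) + leadingSum c (suc i) j + c i j
          ≡⟨ cong₂ (λ p q → p + q + c i j) (sym (leadingSum-≡ i (suc j) i≤n j<n))
                                            (sym (leadingSum-≡ (suc i) j i<n j≤n)) ⟩
        leadingSum a i (suc j) + leadingSum a (suc i) j + c i j ∎)
        where
        open ≡-Reasoning
        i≤n : i ≤ n
        i≤n = <⇒≤ i<n
        j≤n : j ≤ n
        j≤n = <⇒≤ j<n

n≤x+x⇒⌈n/2⌉≤x : ∀ {n x} → n ≤ x + x → ⌈ n /2⌉ ≤ x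
n≤x+x⇒⌈n/2⌉≤x {n} {x} n≤x+x = subst (⌈ n /2⌉ ≤_) (sym (n≡⌈n+n/2⌉ x)) (⌈n/2⌉-mono n≤x+x)

⌈n/2⌉*2≡n+n%2 : ∀ n → ⌈ n /2⌉ * 2 ≡ n + n % 2
⌈n/2⌉*2≡n+n%2 zero          = refl
⌈n/2⌉*2≡n+n%2 (suc zero)    = refl
⌈n/2⌉*2≡n+n%2 (suc (suc n)) =
  cong (suc ∘ suc) (trans (⌈n/2⌉*2≡n+n%2 n) (cong (n +_) (sym n+2%2≡n%2)))
  where
  n+2%2≡n%2 : suc (suc n) % 2 ≡ n % 2
  n+2%2≡n%2 = trans (cong (_% 2) (+-comm 2 n)) ([m+n]%n≡m%n n 2)

-- On 𝒜(n,2), nwPairs ranges over ⌈n/2⌉ … 2n² − 3n − ⌈n/2⌉, that is, over levels n values.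
levels : ℕ → ℕ
levels n = 2 * n * (n ∸ 2) + (1 ∸ n % 2)

levels+⌈n/2⌉*2+n*3 : ∀ {n} → 2 ≤ n → levels n + ⌈ n /2⌉ * 2 + n * 3 ≡ n * n * 2 + 1
levels+⌈n/2⌉*2+n*3 {n@(suc (suc m))} (s≤s (s≤s z≤n)) = begin
  2 * n * m + (1 ∸ n % 2) + ⌈ n /2⌉ * 2 + n * 3
    ≡⟨ cong (λ x → 2 * n * m + (1 ∸ n % 2) + x + n * 3) (⌈n/2⌉*2≡n+n%2 n) ⟩
  2 * n * m + (1 ∸ n % 2) + (n + n % 2) + n * 3
    ≡⟨ regroup m (1 ∸ n % 2) (n % 2) ⟩
  2 * n * m + ((1 ∸ n % 2) + n % 2) + n * 4
    ≡⟨ cong (λ x → 2 * n * m + x + n * 4) (m∸n+n≡m n%2≤1) ⟩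
  2 * n * m + 1 + n * 4
    ≡⟨ expand m ⟩
  n * n * 2 + 1 ∎
  where
  open ≡-Reasoning
  n%2≤1 : n % 2 ≤ 1
  n%2≤1 = ≤-pred (m%n<n n 2)
  regroup : ∀ m u r → let n = suc (suc m) in
            2 * n * m + u + (n + r) + n * 3 ≡ 2 * n * m + (u + r) + n * 4
  regroup = solve-∀
  expand : ∀ m → let n = suc (suc m) in 2 * n * m + 1 + n * 4 ≡ n * n * 2 + 1
  expand = solve-∀

module Counting (n : ℕ) where
  open Quadrants n
  open Rigidity n using (nwPairs; nwPairsBetween-via-SE)

  Binary : (ℕ → ℕ → ℕ) → Set
  Binary a = ∀ i j → a i j ≤ 1

  nePairs : (ℕ → ℕ → ℕ) → ℕ
  nePairs a = ∑∑ (λ i j → a i j * NE a i (suc j))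

  nePairs-via-SW : ∀ a → nePairs a ≡ ∑∑ (λ i j → a i j * SW a (suc i) j)
  nePairs-via-SW a = mass-mass-comm a a (λ i j i′ j′ → [ i′ < i ] * [ j < j′ ])

  positive-by-balance : ∀ {s x y w} → s + x ≡ y + w → x ≤ y → 0 < w → 0 < s
  positive-by-balance {s} {x} {y} {w} s+x≡y+w x≤y 0<w = +-cancelʳ-< x 0 s (begin-strict
    x     ≤⟨ x≤y ⟩
    y     <⟨ m<m+n y 0<w ⟩
    y + w ≡⟨ sym s+x≡y+w ⟩
    s + x ∎)
    where open ≤-Reasoning

  module _ {a} (reg : Regular 2 a) (bin : Binary a) where
    open Regular reg
    open RegularProperties reg

    cell-indicator : ∀ i j → [ i < suc i ] * [ j < suc j ] ≡ 1
    cell-indicator i j = cong₂ _*_ ([<]≡1 (n<1+n i)) ([<]≡1 (n<1+n j))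

    row-has-one-outside : ∀ i → i < n → ∀ j₀ → ∃ λ j → j < n × a i j ≡ 1 × j ≢ j₀
    row-has-one-outside i i<n j₀ with anyUpTo? (λ j → (a i j ≟ 1) ×-dec ¬? (j ≟ j₀)) n
    ... | yes (j , j<n , aᵢⱼ≡1 , j≢j₀) = j , j<n , aᵢⱼ≡1 , j≢j₀
    ... | no none = ⊥-elim (<-irrefl refl (begin-strict
      1              <⟨ n<1+n 1 ⟩
      2              ≡⟨ sym (row-sum i i<n) ⟩
      ∑ n (a i)      ≤⟨ ∑≤term n (a i) j₀ zero-elsewhere ⟩
      a i j₀         ≤⟨ bin i j₀ ⟩
      1              ∎))
      where
      open ≤-Reasoning
      zero-elsewhere : ∀ j → j < n → j ≢ j₀ → a i j ≡ 0
      zero-elsewhere j j<n j≢j₀ with n≤1⇒n≡0∨n≡1 (bin i j)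
      ... | inj₁ aᵢⱼ≡0 = aᵢⱼ≡0
      ... | inj₂ aᵢⱼ≡1 = ⊥-elim (none (j , j<n , aᵢⱼ≡1 , j≢j₀))

    -- Counting the 1s in rows > i and columns > j (resp. rows < i and columns < j) against the
    -- row and column sums shows there is one when i + j + 1 < n (resp. i + j + 1 > n).
    NW-or-SE-partner : ∀ {i j} → i < n → j < n → a i j ≡ 1 → suc (i + j) ≢ n →
                       0 < NW a i j + SE a (suc i) (suc j)
    NW-or-SE-partner {i} {j} i<n j<n aᵢⱼ≡1 i+j+1≢n with <-cmp (suc (i + j)) n
    ... | tri≈ _ i+j+1≡n _ = ⊥-elim (i+j+1≢n i+j+1≡n)
    ... | tri< i+j+1<n _ _ = ≤-trans SE-positive (m≤n+m _ _)
      where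
      SE-positive : 0 < SE a (suc i) (suc j)
      SE-positive = positive-by-balance
        (trans (sym (+-assoc _ (suc i * 2) _)) (SE-balance (suc i) (suc j) i<n j<n))
        (subst (_≤ n * 2) (*-distribʳ-+ 2 (suc i) (suc j))
          (*-monoˡ-≤ 2 (subst (_≤ n) (sym (+-suc (suc i) j)) i+j+1<n)))
        (subst (_≤ NW a (suc i) (suc j)) aᵢⱼ≡1 (entry≤mass a _ i<n j<n (cell-indicator i j)))
    ... | tri> _ _ n<i+j+1 = ≤-trans NW-positive (m≤m+n _ _)
      where
      NW-positive : 0 < NW a i j
      NW-positive = positive-by-balance
        (trans (+-comm (NW a i j) (n * 2))
          (trans (sym (SE-balance i j (<⇒≤ i<n) (<⇒≤ j<n)))
                 (trans (+-assoc (SE a i j) _ _) (+-comm (SE a i j) _))))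
        (subst (n * 2 ≤_) (*-distribʳ-+ 2 i j) (*-monoˡ-≤ 2 (≤-pred n<i+j+1)))
        (subst (_≤ SE a i j) aᵢⱼ≡1 (entry≤mass a _ i<n j<n (cell-indicator i j)))

    NE-or-SW-partner : ∀ {i j} → i < n → j < n → a i j ≡ 1 → i ≢ j →
                       0 < NE a i (suc j) + SW a (suc i) j
    NE-or-SW-partner {i} {j} i<n j<n aᵢⱼ≡1 i≢j with <-cmp i j
    ... | tri≈ _ i≡j _ = ⊥-elim (i≢j i≡j)
    ... | tri< i<j _ _ = ≤-trans SW-positive (m≤n+m _ _)
      where
      SW-positive : 0 < SW a (suc i) j
      SW-positive = positive-by-balance
        (trans (+-comm (SW a (suc i) j) _)
          (trans (sym (NE-balance (suc i) j i<n (<⇒≤ j<n))) (+-comm _ (j * 2))))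
        (*-monoˡ-≤ 2 i<j)
        (subst (_≤ NE a (suc i) j) aᵢⱼ≡1 (entry≤mass a _ i<n j<n (cell-indicator i j)))
    ... | tri> _ _ j<i = ≤-trans NE-positive (m≤m+n _ _)
      where
      NE-positive : 0 < NE a i (suc j)
      NE-positive = positive-by-balance
        (NE-balance i (suc j) (<⇒≤ i<n) j<n)
        (*-monoˡ-≤ 2 j<i)
        (subst (_≤ SW a i (suc j)) aᵢⱼ≡1 (entry≤mass a _ i<n j<n (cell-indicator i j)))

    n≤partnered-mass : ∀ (P Q : ℕ → ℕ → ℕ) →
      (∀ i → i < n → ∃ λ j → j < n × a i j ≡ 1 × 0 < P i j + Q i j) →
      n ≤ mass a P + mass a Q
    n≤partnered-mass P Q partnered = begin
      n                                  ≡⟨ sym (*-identityʳ n) ⟩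
      n * 1                              ≡⟨ sym (∑-const n 1) ⟩
      ∑[ _ < n ] 1                       ≤⟨ ∑-mono-≤ n row-bound ⟩
      mass a (λ i j → P i j + Q i j)     ≡⟨ mass-distrib-+ a P Q ⟩
      mass a P + mass a Q ∎
      where
      open ≤-Reasoning
      row-bound : ∀ i → i < n → 1 ≤ ∑[ j < n ] (a i j * (P i j + Q i j))
      row-bound i i<n with partnered i i<n
      ... | j , j<n , aᵢⱼ≡1 , 0<P+Q = begin
        1                                    ≤⟨ 0<P+Q ⟩
        P i j + Q i j                        ≡⟨ sym (*-identityˡ _) ⟩
        1 * (P i j + Q i j)                  ≡⟨ cong (_* (P i j + Q i j)) (sym aᵢⱼ≡1) ⟩
        a i j * (P i j + Q i j)              ≤⟨ term≤∑ n (λ j → a i j * (P i j + Q i j)) j<n ⟩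
        ∑[ j < n ] (a i j * (P i j + Q i j)) ∎

    n≤nwPairs+nwPairs : n ≤ nwPairs a + nwPairs a
    n≤nwPairs+nwPairs = subst (n ≤_) (cong (nwPairs a +_) (sym (nwPairsBetween-via-SE a a)))
      (n≤partnered-mass (NW a) (λ i j → SE a (suc i) (suc j)) partnered)
      where
      partnered : ∀ i → i < n → ∃ λ j → j < n × a i j ≡ 1 × 0 < NW a i j + SE a (suc i) (suc j)
      partnered i i<n with row-has-one-outside i i<n (n ∸ suc i)
      ... | j , j<n , aᵢⱼ≡1 , j≢n-i-1 =
        j , j<n , aᵢⱼ≡1 , NW-or-SE-partner i<n j<n aᵢⱼ≡1 (λ i+j+1≡n → j≢n-i-1 (begin
          j                   ≡⟨ sym (m+n∸m≡n (suc i) j) ⟩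
          suc (i + j) ∸ suc i ≡⟨ cong (_∸ suc i) i+j+1≡n ⟩
          n ∸ suc i           ∎))
        where open ≡-Reasoning

    n≤nePairs+nePairs : n ≤ nePairs a + nePairs a
    n≤nePairs+nePairs = subst (n ≤_) (cong (nePairs a +_) (sym (nePairs-via-SW a)))
      (n≤partnered-mass (λ i j → NE a i (suc j)) (λ i j → SW a (suc i) j) partnered)
      where
      partnered : ∀ i → i < n → ∃ λ j → j < n × a i j ≡ 1 × 0 < NE a i (suc j) + SW a (suc i) j
      partnered i i<n with row-has-one-outside i i<n i
      ... | j , j<n , aᵢⱼ≡1 , j≢i =
        j , j<n , aᵢⱼ≡1 , NE-or-SW-partner i<n j<n aᵢⱼ≡1 (j≢i ∘ sym)

    column-pairs : mass a (λ i j → ∑[ r < i ] a r j) ≡ n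
    column-pairs = begin
      ∑[ i < n ] ∑[ j < n ] (a i j * ∑[ r < i ] a r j) ≡⟨ ∑∑-transpose _ ⟩
      ∑[ j < n ] ∑[ i < n ] (a i j * ∑[ r < i ] a r j) ≡⟨ ∑-cong n one-pair-per-column ⟩
      ∑[ _ < n ] 1                                      ≡⟨ trans (∑-const n 1) (*-identityʳ n) ⟩
      n ∎
      where
      open ≡-Reasoning
      one-pair-per-column : ∀ j → j < n → ∑[ i < n ] (a i j * ∑[ r < i ] a r j) ≡ 1
      one-pair-per-column j j<n = *-cancelˡ-≡ _ 1 2 (+-cancelʳ-≡ 2 _ (2 * 1) (begin
        2 * ∑[ i < n ] (a i j * ∑[ r < i ] a r j) + 2
          ≡⟨ cong (2 * ∑[ i < n ] (a i j * ∑[ r < i ] a r j) +_) (sym squares) ⟩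
        2 * ∑[ i < n ] (a i j * ∑[ r < i ] a r j) + ∑[ i < n ] (a i j * a i j)
          ≡⟨ ∑-square n (λ i → a i j) ⟩
        ∑[ i < n ] a i j * ∑[ i < n ] a i j
          ≡⟨ cong₂ _*_ (col-sum j j<n) (col-sum j j<n) ⟩
        2 * 1 + 2 ∎))
        where
        idempotent : ∀ i → a i j * a i j ≡ a i j
        idempotent i with n≤1⇒n≡0∨n≡1 (bin i j)
        ... | inj₁ aᵢⱼ≡0 = subst (λ x → x * x ≡ x) (sym aᵢⱼ≡0) refl
        ... | inj₂ aᵢⱼ≡1 = subst (λ x → x * x ≡ x) (sym aᵢⱼ≡1) refl
        squares : ∑[ i < n ] (a i j * a i j) ≡ 2
        squares = trans (∑-cong n (λ i _ → idempotent i)) (col-sum j j<n)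

    pairs-with-rows-above : ∀ i j → i < n → j < n →
                            NW a i j + NE a i (suc j) + ∑[ r < i ] a r j ≡ i * 2
    pairs-with-rows-above i j i<n j<n = begin
      NW a i j + NE a i (suc j) + ∑[ r < i ] a r j
        ≡⟨ rearrange (NW a i j) _ _ ⟩
      NW a i j + ∑[ r < i ] a r j + NE a i (suc j)
        ≡⟨ cong (λ x → x + ∑[ r < i ] a r j + NE a i (suc j)) (sym (leadingSum≡NW a i≤n (<⇒≤ j<n))) ⟩
      leadingSum a i j + ∑[ r < i ] a r j + NE a i (suc j)
        ≡⟨ cong (_+ NE a i (suc j)) (sym (leadingSum-extend a i j)) ⟩
      leadingSum a i (suc j) + NE a i (suc j)
        ≡⟨ cong (_+ NE a i (suc j)) (leadingSum≡NW a i≤n j<n) ⟩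
      NW a i (suc j) + NE a i (suc j)
        ≡⟨ NW+NE i (suc j) i≤n ⟩
      i * 2 ∎
      where
      open ≡-Reasoning
      i≤n : i ≤ n
      i≤n = <⇒≤ i<n
      rearrange : ∀ x y z → x + y + z ≡ x + z + y
      rearrange = solve-∀

    mass-by-row-index : mass a (λ i _ → i * 2) + n * 2 ≡ n * n * 2
    mass-by-row-index = begin
      ∑[ i < n ] ∑[ j < n ] (a i j * (i * 2)) + n * 2
        ≡⟨ cong (_+ n * 2) (∑-cong n (λ i i<n → trans (sym (∑-distribʳ n (i * 2) (a i)))
                                                      (cong (_* (i * 2)) (row-sum i i<n)))) ⟩
      ∑[ i < n ] (2 * (i * 2)) + n * 2
        ≡⟨ cong (_+ n * 2) (sym (∑-distribˡ n 2 _)) ⟩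
      2 * ∑[ i < n ] (i * 2) + n * 2
        ≡⟨ cong (λ x → 2 * x + n * 2) (sym (∑-distribʳ n 2 (λ i → i))) ⟩
      2 * (∑[ i < n ] i * 2) + n * 2
        ≡⟨ regroup (∑[ i < n ] i) n ⟩
      (2 * ∑[ i < n ] i + n) * 2
        ≡⟨ cong (_* 2) (∑-triangle n) ⟩
      n * n * 2 ∎
      where
      open ≡-Reasoning
      regroup : ∀ t n → 2 * (t * 2) + n * 2 ≡ (2 * t + n) * 2
      regroup = solve-∀

    nwPairs+nePairs : nwPairs a + nePairs a + n * 3 ≡ n * n * 2
    nwPairs+nePairs = begin
      nwPairs a + nePairs a + n * 3
        ≡⟨ regroup (nwPairs a + nePairs a) n ⟩
      nwPairs a + nePairs a + n + n * 2
        ≡⟨ cong (λ x → nwPairs a + nePairs a + x + n * 2) (sym column-pairs) ⟩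
      nwPairs a + nePairs a + mass a (λ i j → ∑[ r < i ] a r j) + n * 2
        ≡⟨ cong (λ x → x + mass a (λ i j → ∑[ r < i ] a r j) + n * 2) (sym (mass-distrib-+ a _ _)) ⟩
      mass a (λ i j → NW a i j + NE a i (suc j)) + mass a (λ i j → ∑[ r < i ] a r j) + n * 2
        ≡⟨ cong (_+ n * 2) (sym (mass-distrib-+ a _ _)) ⟩
      mass a (λ i j → NW a i j + NE a i (suc j) + ∑[ r < i ] a r j) + n * 2
        ≡⟨ cong (_+ n * 2) (mass-cong a pairs-with-rows-above) ⟩
      mass a (λ i _ → i * 2) + n * 2
        ≡⟨ mass-by-row-index ⟩
      n * n * 2 ∎
      where
      open ≡-Reasoning
      regroup : ∀ x n → x + n * 3 ≡ x + n + n * 2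
      regroup = solve-∀

    ⌈n/2⌉≤nwPairs : ⌈ n /2⌉ ≤ nwPairs a
    ⌈n/2⌉≤nwPairs = n≤x+x⇒⌈n/2⌉≤x n≤nwPairs+nwPairs

    nwPairs<⌈n/2⌉+levels : 2 ≤ n → nwPairs a < ⌈ n /2⌉ + levels n
    nwPairs<⌈n/2⌉+levels 2≤n = +-cancelʳ-< (⌈ n /2⌉ + n * 3) _ _ (begin-strict
      nwPairs a + (⌈ n /2⌉ + n * 3)
        ≤⟨ +-monoʳ-≤ (nwPairs a) (+-monoˡ-≤ (n * 3) (n≤x+x⇒⌈n/2⌉≤x n≤nePairs+nePairs)) ⟩
      nwPairs a + (nePairs a + n * 3)       ≡⟨ sym (+-assoc (nwPairs a) _ _) ⟩
      nwPairs a + nePairs a + n * 3         ≡⟨ nwPairs+nePairs ⟩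
      n * n * 2                             <⟨ n<1+n _ ⟩
      suc (n * n * 2)                       ≡⟨ +-comm 1 _ ⟩
      n * n * 2 + 1                         ≡⟨ sym (levels+⌈n/2⌉*2+n*3 2≤n) ⟩
      levels n + ⌈ n /2⌉ * 2 + n * 3        ≡⟨ regroup (levels n) ⌈ n /2⌉ (n * 3) ⟩
      ⌈ n /2⌉ + levels n + (⌈ n /2⌉ + n * 3) ∎)
      where
      open ≤-Reasoning
      regroup : ∀ l h t → l + h * 2 + t ≡ h + l + (h + t)
      regroup = solve-∀

    nwPairs-level<levels : 2 ≤ n → nwPairs a ∸ ⌈ n /2⌉ < levels n
    nwPairs-level<levels 2≤n = subst (nwPairs a ∸ ⌈ n /2⌉ <_) (m+n∸m≡n ⌈ n /2⌉ (levels n))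
      (∸-monoˡ-< (nwPairs<⌈n/2⌉+levels 2≤n) ⌈n/2⌉≤nwPairs)

rowEntry : ∀ {m} → Vec Bool m → ℕ → ℕ
rowEntry []       _       = 0
rowEntry (b ∷ _)  zero    = b2n b
rowEntry (_ ∷ bs) (suc j) = rowEntry bs j

entry : ∀ {m n} → Vec (Vec Bool n) m → ℕ → ℕ → ℕ
entry []       _       _ = 0
entry (r ∷ _)  zero    j = rowEntry r j
entry (_ ∷ rs) (suc i) j = entry rs i j

σ≡leadingSum : ∀ {n} (A : Mat n) i j → σ A i j ≡ leadingSum (entry A) i j
σ≡leadingSum A = rows A
  where
  row : ∀ {m} (r : Vec Bool m) j → sum (take j (List.map b2n (toList r))) ≡ ∑ j (rowEntry r)
  row []       zero    = refl
  row []       (suc j) = sym (∑-zero (suc j))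
  row (b ∷ bs) zero    = refl
  row (b ∷ bs) (suc j) = cong (b2n b +_) (row bs j)
  rows : ∀ {m n} (A : Vec (Vec Bool n) m) i j →
         sum (List.map (λ r → sum (take j (List.map b2n (toList r)))) (take i (toList A))) ≡
         leadingSum (entry A) i j
  rows []      zero    j = refl
  rows []      (suc i) j = sym (trans (∑-cong (suc i) (λ _ _ → ∑-zero j)) (∑-zero (suc i)))
  rows (r ∷ A) zero    j = refl
  rows (r ∷ A) (suc i) j = cong₂ _+_ (row r j) (rows A i j)

∑-rowEntry : ∀ {m} (r : Vec Bool m) → ∑ m (rowEntry r) ≡ lineSum r
∑-rowEntry []      = refl
∑-rowEntry (b ∷ r) = cong (b2n b +_) (∑-rowEntry r)

∑-entry-row : ∀ {m n k} (A : Vec (Vec Bool n) m) → VAll.All (λ r → lineSum r ≡ k) A →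
              ∀ i → i < m → ∑ n (entry A i) ≡ k
∑-entry-row (r ∷ A) (lineSum≡k ∷ _)  zero    _         = trans (∑-rowEntry r) lineSum≡k
∑-entry-row (r ∷ A) (_ ∷ lineSums≡k) (suc i) (s≤s i<m) = ∑-entry-row A lineSums≡k i i<m

entry-transpose : ∀ {m n} (A : Vec (Vec Bool n) m) i j → entry (transpose A) j i ≡ entry A i j
entry-transpose {n = n} []      i       j = entry-empty-rows n j
  where
  entry-empty-rows : ∀ n j → entry (replicate n []) j i ≡ 0
  entry-empty-rows zero    j       = refl
  entry-empty-rows (suc n) zero    = refl
  entry-empty-rows (suc n) (suc j) = entry-empty-rows n j
entry-transpose (r ∷ A) zero    j = entry-first-column r (transpose A) j
  where
  entry-first-column : ∀ {m n} (r : Vec Bool n) (B : Vec (Vec Bool m) n) j →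
                       entry (replicate n _∷_ ⊛ r ⊛ B) j zero ≡ rowEntry r j
  entry-first-column []      []      j       = refl
  entry-first-column (x ∷ r) (b ∷ B) zero    = refl
  entry-first-column (x ∷ r) (b ∷ B) (suc j) = entry-first-column r B j
entry-transpose (r ∷ A) (suc i) j = trans (entry-later-column r (transpose A) j) (entry-transpose A i j)
  where
  entry-later-column : ∀ {m n} (r : Vec Bool n) (B : Vec (Vec Bool m) n) j →
                       entry (replicate n _∷_ ⊛ r ⊛ B) j (suc i) ≡ entry B j i
  entry-later-column []      []      j       = refl
  entry-later-column (x ∷ r) (b ∷ B) zero    = refl
  entry-later-column (x ∷ r) (b ∷ B) (suc j) = entry-later-column r B j

regular : ∀ {n k} (A : Mat n) → InA n k A → Quadrants.Regular n k (entry A)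
regular {n} A (rows , cols) = record
  { row-sum = ∑-entry-row A rows
  ; col-sum = λ j j<n → trans (∑-cong n (λ i _ → sym (entry-transpose A i j)))
                              (∑-entry-row (transpose A) cols j j<n)
  }

binary : ∀ {n} (A : Mat n) → Counting.Binary n (entry A)
binary A i j = entry≤1 A i j
  where
  b2n≤1 : ∀ b → b2n b ≤ 1
  b2n≤1 true  = ≤-refl
  b2n≤1 false = z≤n
  rowEntry≤1 : ∀ {m} (r : Vec Bool m) j → rowEntry r j ≤ 1
  rowEntry≤1 []      j       = z≤n
  rowEntry≤1 (b ∷ r) zero    = b2n≤1 b
  rowEntry≤1 (b ∷ r) (suc j) = rowEntry≤1 r j
  entry≤1 : ∀ {m n} (A : Vec (Vec Bool n) m) i j → entry A i j ≤ 1
  entry≤1 []      i       j = z≤n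
  entry≤1 (r ∷ A) zero    j = rowEntry≤1 r j
  entry≤1 (r ∷ A) (suc i) j = entry≤1 A i j

entry-injective : ∀ {m n} (A C : Vec (Vec Bool n) m) →
                  (∀ i j → i < m → j < n → entry A i j ≡ entry C i j) → A ≡ C
entry-injective []      []      _      = refl
entry-injective (r ∷ A) (s ∷ C) same = cong₂ _∷_
  (rowEntry-injective r s (λ j j<n → same 0 j (s≤s z≤n) j<n))
  (entry-injective A C (λ i j i<m j<n → same (suc i) j (s≤s i<m) j<n))
  where
  b2n-injective : ∀ x y → b2n x ≡ b2n y → x ≡ y
  b2n-injective true  true  _ = refl
  b2n-injective false false _ = refl
  rowEntry-injective : ∀ {n} (r s : Vec Bool n) →
                       (∀ j → j < n → rowEntry r j ≡ rowEntry s j) → r ≡ s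
  rowEntry-injective []      []      _    = refl
  rowEntry-injective (x ∷ r) (y ∷ s) same = cong₂ _∷_
    (b2n-injective x y (same 0 (s≤s z≤n)))
    (rowEntry-injective r s (λ j j<n → same (suc j) (s≤s j<n)))

⪯B⇒Dominates : ∀ {n} {A C : Mat n} → A ⪯B C → Rigidity.Dominates n (entry A) (entry C)
⪯B⇒Dominates A⪯C zero    j       _   _   = z≤n
⪯B⇒Dominates A⪯C (suc i) zero    _   _   = ≤-refl
⪯B⇒Dominates {A = A} {C} A⪯C (suc i) (suc j) i≤n j≤n =
  subst₂ _≤_ (σ≡leadingSum C (suc i) (suc j)) (σ≡leadingSum A (suc i) (suc j))
    (A⪯C (suc i) (suc j) (s≤s z≤n) i≤n (s≤s z≤n) j≤n)

comparable∧same-nwPairs⇒≡ : ∀ {n k} {A C : Mat n} → InA n k A → InA n k C → A ⪯B C →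
  Rigidity.nwPairs n (entry A) ≡ Rigidity.nwPairs n (entry C) → A ≡ C
comparable∧same-nwPairs⇒≡ {A = A} {C} A∈ C∈ A⪯C same =
  entry-injective A C (Rigidity.entries-≡ _ (regular A A∈) (regular C C∈) (⪯B⇒Dominates A⪯C) same)

module _ {X : Set} where

  length-partition : ∀ {P : X → Set} (P? : Decidable P) xs →
                     length xs ≡ length (filter P? xs) + length (filter (¬? ∘ P?) xs)
  length-partition P? []       = refl
  length-partition P? (x ∷ xs) with P? x
  ... | yes _ = cong suc (length-partition P? xs)
  ... | no  _ = trans (cong suc (length-partition P? xs)) (sym (+-suc _ _))

  fibre : (X → ℕ) → ℕ → List X → List X
  fibre f v = filter (λ x → f x ≟ v)

  pigeonhole : ∀ (f : X → ℕ) K xs → All (λ x → f x < K) xs →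
               ∃ λ v → length xs ≤ K * length (fibre f v xs)
  pigeonhole f zero    []       _       = 0 , z≤n
  pigeonhole f zero    (x ∷ xs) (() ∷ _)
  pigeonhole f (suc K) xs       bounded = choose (pigeonhole f K rest rest-bounded)
    where
    rest : List X
    rest = filter (λ x → ¬? (f x ≟ K)) xs
    rest-bounded : All (λ x → f x < K) rest
    rest-bounded = All.map (λ (fx<1+K , fx≢K) → ≤∧≢⇒< (≤-pred fx<1+K) fx≢K)
                           (All.zip (filter⁺ _ bounded , all-filter _ xs))
    choose : (∃ λ v → length rest ≤ K * length (fibre f v rest)) →
             ∃ λ v → length xs ≤ suc K * length (fibre f v xs)
    choose (v , rest≤) with length (fibre f v rest) ≤? length (fibre f K xs)
    ... | yes ≤top = K , (begin
      length xs
        ≡⟨ length-partition (λ x → f x ≟ K) xs ⟩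
      length (fibre f K xs) + length rest
        ≤⟨ +-monoʳ-≤ _ (≤-trans rest≤ (*-monoʳ-≤ K ≤top)) ⟩
      length (fibre f K xs) + K * length (fibre f K xs) ∎)
      where open ≤-Reasoning
    ... | no  >top = v , (begin
      length xs
        ≡⟨ length-partition (λ x → f x ≟ K) xs ⟩
      length (fibre f K xs) + length rest
        ≤⟨ +-mono-≤ (<⇒≤ (≰⇒> >top)) rest≤ ⟩
      length (fibre f v rest) + K * length (fibre f v rest)
        ≤⟨ *-monoʳ-≤ (suc K) fibre-rest≤fibre ⟩
      suc K * length (fibre f v xs) ∎)
      where
      open ≤-Reasoning
      fibre-rest≤fibre : length (fibre f v rest) ≤ length (fibre f v xs)
      fibre-rest≤fibre =
        length-mono-≤ (⊆-filter⁺ (λ x → f x ≟ v) (λ x → f x ≟ v) (λ { refl p → p }) (filter-⊆ _ xs))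

vecsOver-unique : ∀ {A : Set} {xs : List A} → Unique xs → ∀ m → Unique (vecsOver xs m)
vecsOver-unique _ zero = [] ∷ []
vecsOver-unique {A} {xs} xs-unique (suc m) =
  Unique.concat⁺ (All.map⁺ each-unique) (AllPairs.map⁺ disjoint)
  where
  prefixed : A → List (Vec A (suc m))
  prefixed x = List.map (x ∷_) (vecsOver xs m)
  each-unique : All (λ x → Unique (prefixed x)) xs
  each-unique = All.universal (λ x → Unique.map⁺ ∷-injectiveʳ (vecsOver-unique xs-unique m)) xs
  disjoint : AllPairs (λ x y → Disjoint (prefixed x) (prefixed y)) xs
  disjoint = AllPairs.map (λ x≢y {v} (v∈x , v∈y) → x≢y (same-head (∈-map⁻ _ v∈x) (∈-map⁻ _ v∈y)))
                          xs-unique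
    where
    same-head : ∀ {x y v} → (∃ λ u → u ∈ vecsOver xs m × v ≡ x ∷ u) →
                (∃ λ u → u ∈ vecsOver xs m × v ≡ y ∷ u) → x ≡ y
    same-head (_ , _ , v≡x∷u) (_ , _ , v≡y∷u′) = ∷-injectiveˡ (trans (sym v≡x∷u) v≡y∷u′)

AllPairs-mapWithAll : ∀ {X : Set} {P : X → Set} {R S : X → X → Set} →
  (∀ {x y} → P x → P y → R x y → S x y) → ∀ {xs} → All P xs → AllPairs R xs → AllPairs S xs
AllPairs-mapWithAll upgrade []         []         = []
AllPairs-mapWithAll upgrade (px ∷ pxs) (rx ∷ rxs) =
  All.zipWith (λ (py , rxy) → upgrade px py rxy) (pxs , rx) ∷ AllPairs-mapWithAll upgrade pxs rxs

level : ∀ n → Mat n → ℕ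
level n A = Rigidity.nwPairs n (entry A) ∸ ⌈ n /2⌉

level<levels : ∀ {n} {A : Mat n} → 2 ≤ n → InA n 2 A → level n A < levels n
level<levels {n} {A} 2≤n A∈ = Counting.nwPairs-level<levels n (regular A A∈) (binary A) 2≤n

distinct-same-level⇒Incomparable : ∀ {n} {A C : Mat n} → InA n 2 A → InA n 2 C → A ≢ C →
                                   level n A ≡ level n C → Incomparable A C
distinct-same-level⇒Incomparable {n} {A} {C} A∈ C∈ A≢C same-level =
  (λ A⪯C → A≢C (comparable∧same-nwPairs⇒≡ A∈ C∈ A⪯C same-nwPairs)) ,
  (λ C⪯A → A≢C (sym (comparable∧same-nwPairs⇒≡ C∈ A∈ C⪯A (sym same-nwPairs))))
  where
  same-nwPairs : Rigidity.nwPairs n (entry A) ≡ Rigidity.nwPairs n (entry C)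
  same-nwPairs = ∸-cancelʳ-≡ (Counting.⌈n/2⌉≤nwPairs n (regular A A∈) (binary A))
                             (Counting.⌈n/2⌉≤nwPairs n (regular C C∈) (binary C)) same-level

enumA : (n k : ℕ) → List (Mat n)
enumA n k = filter (inA? n k) (allMats n)

enumA-members : ∀ n k → All (InA n k) (enumA n k)
enumA-members n k = all-filter (inA? n k) (allMats n)

enumA-unique : ∀ n k → Unique (enumA n k)
enumA-unique n k = Unique.filter⁺ (inA? n k) (vecsOver-unique (vecsOver-unique (((λ ()) ∷ []) ∷ [] ∷ []) n) n)

levelSet-antichain : ∀ n v → AllPairs Incomparable (fibre (level n) v (enumA n 2))
levelSet-antichain n v = AllPairs-mapWithAll
  (λ (A∈ , A-level) (C∈ , C-level) A≢C →
     distinct-same-level⇒Incomparable A∈ C∈ A≢C (trans A-level (sym C-level)))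
  (All.zip (filter⁺ _ (enumA-members n 2) , all-filter _ (enumA n 2)))
  (Unique.filter⁺ _ (enumA-unique n 2))

corollary2 : (n : ℕ) → 3 ≤ n →
    Σ (List (Mat n)) (λ S →
      All (InA n 2) S × AllPairs Incomparable S ×
      cardA n 2 ≤ length S * (2 * n * (n ∸ 2) + (1 ∸ n % 2)))
corollary2 n 3≤n
  with pigeonhole (level n) (levels n) (enumA n 2) (All.map (level<levels (<⇒≤ 3≤n)) (enumA-members n 2))
... | v , crowded =
  fibre (level n) v (enumA n 2) ,
  filter⁺ _ (enumA-members n 2) ,
  levelSet-antichain n v ,
  subst (cardA n 2 ≤_) (*-comm (levels n) _) crowded
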